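{- Let $m\ge 2$ be an integer, let $x\in[\![m]\!]\setminus\{0\}$, let $w$ be a word over $[\![m]\!]$ with $w[0]=x$, and let $t=(w)_m$. Let $(u_k)_{k\in\mathbb N}$ be the sequence of words over $[\![m]\!]$ defined by: $u_0$ has length $m^{|w|}$ with $u_0[i]=1$ if $i=t$ and $u_0[i]=0$ otherwise ($0\le i<m^{|w|}$), and $u_{k+1}=u_k^{\,x}\,\phi_w(u_k)\,u_k^{\,m-x-1}$ for $k\ge 0$. Then $\lim_{k\to\infty}u_k=(a_{m;w}(n))_{n\in\mathbb N}$.
   Context: $[\![m]\!]=\{0,\dots,m-1\}$. Words are indexed from $0$: $v=v[0]v[1]\cdots v[|v|-1]$; $v^j$ is the concatenation of $j$ copies of $v$ ($v^0$ empty). For a word $v$ over $[\![m]\!]$, $(v)_m=\sum_{i=0}^{|v|-1}v[i]m^{|v|-1-i}$ (with $(\varepsilon)_m=0$), and $v'=v[1]\cdots v[|v|-1]$. For the word $w$, set $\alpha_w=(w')_m/m^{|w|-1}$ and $\beta_w=((w')_m+1)/m^{|w|-1}$, and define $\phi_w$ on words $v$ over $[\![m]\!]$ by $|\phi_w(v)|=|v|$ and $\phi_w(v)[i]=v[i]+1 \bmod m$ if $\alpha_w|v|\le i<\beta_w|v|$, $\phi_w(v)[i]=v[i]$ otherwise. For $n\ge0$, $[n]_m$ is the base-$m$ expansion of $n$ without leading zeros, with $[0]_m=0$; $e_{m;w}(n)$ is the number of occurrences of $w$ as a factor (contiguous block, counted at every starting position) of $[n]_m$, and $a_{m;w}(n)\in[\![m]\!]$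 with $a_{m;w}(n)\equiv e_{m;w}(n)\pmod m$. The limit of finite words $u_k$ is the infinite word whose prefix of length $|u_k|$ is $u_k$ for every $k$. -}

module Defs where

open import Data.Nat using (ℕ; zero; suc; _+_; _*_; _∸_; _^_; _≡ᵇ_; _<ᵇ_; _≤ᵇ_; NonZero)
open import Data.Nat.DivMod using (_/_; _%_)
open import Data.Bool using (Bool; true; false; if_then_else_; _∧_)
open import Data.List using (List; []; _∷_; _++_; length; map; foldl; drop; upTo; zipWith; concat; replicate)

-- Words over [[m]] are lists of naturals (letters assumed < m where relevant).

val : ℕ → List ℕ → ℕ
val m v = foldl (λ acc d → acc * m + d) 0 v

tail′ : List ℕ → List ℕ
tail′ v = drop 1 v

-- phi_w(v): letter i is incremented mod m iff alpha_w |v| ≤ i < beta_w |v|,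
-- where alpha_w = (w')_m / m^(|w|-1), beta_w = ((w')_m + 1) / m^(|w|-1).
-- Cleared of denominators: p*|v| ≤ i*D  and  i*D < (p+1)*|v|, D = m^(|w|-1), p = (w')_m.
inRange : ℕ → List ℕ → ℕ → ℕ → Bool
inRange m w L i =
  let D = m ^ (length w ∸ 1)
      p = val m (tail′ w)
  in (p * L ≤ᵇ i * D) ∧ (i * D <ᵇ (p + 1) * L)

φ : (m : ℕ) .{{_ : NonZero m}} → List ℕ → List ℕ → List ℕ
φ m w v = zipWith (λ i d → if inRange m w (length v) i then (d + 1) % m else d)
                  (upTo (length v)) v

u₀ : ℕ → List ℕ → List ℕ
u₀ m w = map (λ i → if i ≡ᵇ val m w then 1 else 0) (upTo (m ^ length w))

u : (m : ℕ) .{{_ : NonZero m}} → ℕ → List ℕ → ℕ → List ℕ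
u m x w zero = u₀ m w
u m x w (suc k) =
  let uk = u m x w k in
  concat (replicate x uk) ++ φ m w uk ++ concat (replicate (m ∸ x ∸ 1) uk)

-- [n]_m : base-m expansion of n without leading zeros, [0]_m = 0.
-- digitsAux fuel n acc prepends the base-m digits of n to acc (fuel ≥ n suffices).
digitsAux : (m : ℕ) .{{_ : NonZero m}} → ℕ → ℕ → List ℕ → List ℕ
digitsAux m zero n acc = acc
digitsAux m (suc f) zero acc = acc
digitsAux m (suc f) (suc n) acc = digitsAux m f (suc n / m) (suc n % m ∷ acc)

baseExp : (m : ℕ) .{{_ : NonZero m}} → ℕ → List ℕ
baseExp m zero = 0 ∷ []
baseExp m (suc n) = digitsAux m (suc n) (suc n) []

isPrefix : List ℕ → List ℕ → Bool
isPrefix [] s = true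
isPrefix (a ∷ w) [] = false
isPrefix (a ∷ w) (b ∷ s) = (a ≡ᵇ b) ∧ isPrefix w s

occ : List ℕ → List ℕ → ℕ
occ w [] = 0
occ w (c ∷ s) = (if isPrefix w (c ∷ s) then 1 else 0) + occ w s

e : (m : ℕ) .{{_ : NonZero m}} → List ℕ → ℕ → ℕ
e m w n = occ w (baseExp m n)

a : (m : ℕ) .{{_ : NonZero m}} → List ℕ → ℕ → ℕ
a m w n = e m w n % m

-- Read n < m ^ (N + 1) as a leading digit q followed by the N-digit block r, padded with leading
-- zeros; the padding creates no occurrences of w because w[0] = x ≠ 0. So the occurrences of w in
-- n are those in r plus one at the front exactly when q = x and the top |w| - 1 digits of r spell
-- w′, i.e. ⌊r / m ^ (N + 1 - |w|)⌋ = (w′)_m, i.e. α_w m ^ N ≤ r < β_w m ^ N. Hence the table of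
-- a_{m;w} below m ^ (N + 1) consists of m copies of the table below m ^ N, the copy with leading
-- digit x being incremented mod m on that window: this is u_{k+1} = u_k^x φ_w(u_k) u_k^(m-x-1).
-- Below m ^ |w| the only possible occurrence is the whole padded word, which gives u_0.

module Submission where

open import Defs
open import Data.Nat using (ℕ; _≤_; _<_; NonZero)
open import Data.List using (List; length; head; lookup)
open import Data.List.Relation.Unary.All using (All)
open import Data.Maybe using (just)
open import Data.Fin using (fromℕ<)
open import Data.Product using (_×_; ∃)
open import Relation.Binary.PropositionalEquality using (_≡_)

open import Data.Bool using (Bool; true; false; T; if_then_else_; _∧_)
open import Data.Bool.Properties using (T-∧; T-≡; ∧-zeroʳ)
open import Data.Empty using (⊥-elim)
open import Data.Fin.Properties using (toℕ-fromℕ<)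
open import Data.List using ([]; _∷_; _++_; applyUpTo; upTo; zipWith; replicate; concat; foldl)
open import Data.List.Properties using (length-applyUpTo; lookup-applyUpTo; map-upTo; ++-assoc; ++-identityʳ)
open import Data.List.Relation.Unary.All using ([]; _∷_)
open import Data.Nat using (zero; suc; _+_; _*_; _∸_; _^_; _≡ᵇ_; _<ᵇ_; _≤ᵇ_; s≤s; z<s; s<s)
open import Data.Nat.DivMod
open import Data.Nat.Divisibility using (divides; divides-refl)
open import Data.Nat.Properties
open import Data.Nat.Tactic.RingSolver using (solve-∀)
open import Data.Product using (_,_; Σ-syntax)
open import Data.Unit using (tt)
open import Function using (_∘_; Equivalence)
open import Relation.Binary.PropositionalEquality
  using (refl; sym; trans; cong; cong₂; subst; _≢_; module ≡-Reasoning)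

T-ext : ∀ {b c : Bool} → (T b → T c) → (T c → T b) → b ≡ c
T-ext {false} {false} _ _ = refl
T-ext {false} {true}  _ g = ⊥-elim (g tt)
T-ext {true}  {false} f _ = ⊥-elim (f tt)
T-ext {true}  {true}  _ _ = refl

module _ {A : Set} where

  applyUpTo-cong : ∀ {f g : ℕ → A} n → (∀ i → i < n → f i ≡ g i) → applyUpTo f n ≡ applyUpTo g n
  applyUpTo-cong zero    _   = refl
  applyUpTo-cong (suc n) f≗g =
    cong₂ _∷_ (f≗g 0 z<s) (applyUpTo-cong n (λ i i<n → f≗g (suc i) (s<s i<n)))

  applyUpTo-++ : ∀ (f : ℕ → A) p q →
    applyUpTo f (p + q) ≡ applyUpTo f p ++ applyUpTo (λ r → f (p + r)) q
  applyUpTo-++ f zero    q = refl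
  applyUpTo-++ f (suc p) q = cong (f 0 ∷_) (applyUpTo-++ (f ∘ suc) p q)

  applyUpTo-concat-replicate : ∀ (f : ℕ → A) L (block : List A) c →
    (∀ j → j < c → applyUpTo (λ r → f (j * L + r)) L ≡ block) →
    applyUpTo f (c * L) ≡ concat (replicate c block)
  applyUpTo-concat-replicate f L block zero    _      = refl
  applyUpTo-concat-replicate f L block (suc c) blocks = begin
    applyUpTo f (L + c * L)                              ≡⟨ applyUpTo-++ f L (c * L) ⟩
    applyUpTo f L ++ applyUpTo (λ r → f (L + r)) (c * L) ≡⟨ cong₂ _++_ (blocks 0 z<s) rest ⟩
    block ++ concat (replicate c block)                  ∎
    where
    open ≡-Reasoning
    rest : applyUpTo (λ r → f (L + r)) (c * L) ≡ concat (replicate c block)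
    rest = applyUpTo-concat-replicate (λ r → f (L + r)) L block c λ j j<c →
      trans (applyUpTo-cong L (λ r _ → cong f (sym (+-assoc L (j * L) r)))) (blocks (suc j) (s<s j<c))

  lookup-≡applyUpTo : ∀ {f : ℕ → A} {n} {v : List A} → v ≡ applyUpTo f n →
    ∀ {i} (i<∣v∣ : i < length v) → lookup v (fromℕ< i<∣v∣) ≡ f i
  lookup-≡applyUpTo {f} {n} refl i<∣v∣ =
    trans (lookup-applyUpTo f n (fromℕ< i<∣v∣)) (cong f (toℕ-fromℕ< i<∣v∣))

zipWith-applyUpTo : ∀ {A B C : Set} (h : A → B → C) (f : ℕ → A) (g : ℕ → B) n →
  zipWith h (applyUpTo f n) (applyUpTo g n) ≡ applyUpTo (λ i → h (f i) (g i)) n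
zipWith-applyUpTo h f g zero    = refl
zipWith-applyUpTo h f g (suc n) =
  cong (h (f 0) (g 0) ∷_) (zipWith-applyUpTo h (f ∘ suc) (g ∘ suc) n)

[q*n+r]/n≡q : ∀ q {r} n .{{_ : NonZero n}} → r < n → (q * n + r) / n ≡ q
[q*n+r]/n≡q q {r} n r<n = trans (+-distrib-/-∣ˡ r (divides-refl q))
  (trans (cong₂ _+_ (m*n/n≡m q n) (m<n⇒m/n≡0 r<n)) (+-identityʳ q))

[q*n+r]%n≡r : ∀ q {r} n .{{_ : NonZero n}} → r < n → (q * n + r) % n ≡ r
[q*n+r]%n≡r q {r} n r<n = trans (%-remove-+ˡ r (divides-refl q)) (m<n⇒m%n≡m r<n)

q*n+r<m*n : ∀ {q m n r} → q < m → r < n → q * n + r < m * n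
q*n+r<m*n {q} {m} {n} {r} q<m r<n = begin-strict
  q * n + r <⟨ +-monoʳ-< (q * n) r<n ⟩
  q * n + n ≡⟨ +-comm (q * n) n ⟩
  suc q * n ≤⟨ *-monoˡ-≤ n q<m ⟩
  m * n     ∎
  where open ≤-Reasoning

[1+t]%n≡[t%n+1]%n : ∀ t n .{{_ : NonZero n}} → (1 + t) % n ≡ (t % n + 1) % n
[1+t]%n≡[t%n+1]%n t n = begin
  (1 + t) % n             ≡⟨ cong (_% n) (+-comm 1 t) ⟩
  (t + 1) % n             ≡⟨ %-distribˡ-+ t 1 n ⟩
  (t % n + 1 % n) % n     ≡⟨ cong (λ s → (s + 1 % n) % n) (sym (m%n%n≡m%n t n)) ⟩
  (t % n % n + 1 % n) % n ≡⟨ sym (%-distribˡ-+ (t % n) 1 n) ⟩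
  (t % n + 1) % n         ∎
  where open ≡-Reasoning

≡ᵇ-radix : ∀ B .{{_ : NonZero B}} c d {y z} → y < B → z < B →
  (y + c * B ≡ᵇ z + d * B) ≡ ((d ≡ᵇ c) ∧ (y ≡ᵇ z))
≡ᵇ-radix B c d {y} {z} y<B z<B = T-ext to from
  where
  to : T (y + c * B ≡ᵇ z + d * B) → T ((d ≡ᵇ c) ∧ (y ≡ᵇ z))
  to t = Equivalence.from T-∧ (≡⇒≡ᵇ d c (sym c≡d) , ≡⇒≡ᵇ y z y≡z)
    where
    eq : c * B + y ≡ d * B + z
    eq = trans (+-comm (c * B) y) (trans (≡ᵇ⇒≡ _ _ t) (+-comm z (d * B)))
    c≡d : c ≡ d
    c≡d = trans (sym ([q*n+r]/n≡q c B y<B)) (trans (cong (_/ B) eq) ([q*n+r]/n≡q d B z<B))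
    y≡z : y ≡ z
    y≡z = +-cancelˡ-≡ (c * B) y z (trans eq (cong (λ s → s * B + z) (sym c≡d)))
  from : T ((d ≡ᵇ c) ∧ (y ≡ᵇ z)) → T (y + c * B ≡ᵇ z + d * B)
  from t with Equivalence.to T-∧ t
  ... | d≡c , y≡z =
    ≡⇒≡ᵇ _ _ (cong₂ (λ s t → s + t * B) (≡ᵇ⇒≡ y z y≡z) (sym (≡ᵇ⇒≡ d c d≡c)))

inWindow≡quotient : ∀ D N p r .{{_ : NonZero D}} .{{_ : NonZero N}} →
  ((p * (D * N) ≤ᵇ r * D) ∧ (r * D <ᵇ (p + 1) * (D * N))) ≡ (r / N ≡ᵇ p)
inWindow≡quotient D N p r = T-ext to from
  where
  rescale : ∀ q → q * (D * N) ≡ q * N * D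
  rescale q = trans (cong (q *_) (*-comm D N)) (sym (*-assoc q N D))
  to : T ((p * (D * N) ≤ᵇ r * D) ∧ (r * D <ᵇ (p + 1) * (D * N))) → T (r / N ≡ᵇ p)
  to t with Equivalence.to T-∧ t
  ... | lower , upper = ≡⇒≡ᵇ _ _ (≤-antisym r/N≤p p≤r/N)
    where
    pN≤r : p * N ≤ r
    pN≤r = *-cancelʳ-≤ (p * N) r D (subst (_≤ r * D) (rescale p) (≤ᵇ⇒≤ _ _ lower))
    r<[p+1]N : r < (p + 1) * N
    r<[p+1]N = *-cancelʳ-< D r ((p + 1) * N)
                 (subst (r * D <_) (rescale (p + 1)) (<ᵇ⇒< _ _ upper))
    p≤r/N : p ≤ r / N
    p≤r/N = subst (_≤ r / N) (m*n/n≡m p N) (/-monoˡ-≤ N pN≤r)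
    r/N≤p : r / N ≤ p
    r/N≤p = ≤-pred (subst (suc (r / N) ≤_) (+-comm p 1) (m<n*o⇒m/o<n r<[p+1]N))
  from : T (r / N ≡ᵇ p) → T ((p * (D * N) ≤ᵇ r * D) ∧ (r * D <ᵇ (p + 1) * (D * N)))
  from t = Equivalence.from T-∧
    ( ≤⇒≤ᵇ (subst (_≤ r * D) (sym (rescale p)) (*-monoˡ-≤ D pN≤r))
    , <⇒<ᵇ (subst (r * D <_) (sym (rescale (p + 1))) (*-monoˡ-< D r<[p+1]N)) )
    where
    open ≤-Reasoning
    r/N≡p : r / N ≡ p
    r/N≡p = ≡ᵇ⇒≡ _ _ t
    pN≤r : p * N ≤ r
    pN≤r = subst (λ s → s * N ≤ r) r/N≡p (m/n*n≤m r N)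
    r<[p+1]N : r < (p + 1) * N
    r<[p+1]N = begin-strict
      r                 ≡⟨ m≡m%n+[m/n]*n r N ⟩
      r % N + r / N * N <⟨ +-monoˡ-< (r / N * N) (m%n<n r N) ⟩
      N + r / N * N     ≡⟨ cong (λ s → N + s * N) r/N≡p ⟩
      (1 + p) * N       ≡⟨ cong (_* N) (+-comm 1 p) ⟩
      (p + 1) * N       ∎

n<m^n : ∀ {m} → 2 ≤ m → ∀ n → n < m ^ n
n<m^n 2≤m zero    = z<s
n<m^n {m@(suc _)} 2≤m (suc n) = begin-strict
  suc n         ≡⟨ sym (+-identityʳ (suc n)) ⟩
  suc n + 0     <⟨ +-mono-≤-< (n<m^n 2≤m n) (m^n>0 m n) ⟩
  m ^ n + m ^ n ≡⟨ cong (m ^ n +_) (sym (+-identityʳ (m ^ n))) ⟩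
  2 * m ^ n     ≤⟨ *-monoˡ-≤ (m ^ n) 2≤m ⟩
  m * m ^ n     ∎
  where open ≤-Reasoning

x+suc[m∸x∸1]≡m : ∀ {x m} → x < m → x + suc (m ∸ x ∸ 1) ≡ m
x+suc[m∸x∸1]≡m {zero}  {suc m} _         = refl
x+suc[m∸x∸1]≡m {suc x} {suc m} (s<s x<m) = cong suc (x+suc[m∸x∸1]≡m x<m)

isPrefix-short : ∀ v s → length s < length v → isPrefix v s ≡ false
isPrefix-short (c ∷ v) []      _             = refl
isPrefix-short (c ∷ v) (b ∷ s) (s<s ∣s∣<∣v∣)
  rewrite isPrefix-short v s ∣s∣<∣v∣ = ∧-zeroʳ (c ≡ᵇ b)

occ-short : ∀ w s → length s < length w → occ w s ≡ 0
occ-short w []      _          = refl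
occ-short w (c ∷ s) ∣cs∣<∣w∣
  rewrite isPrefix-short w (c ∷ s) ∣cs∣<∣w∣ = occ-short w s (<-trans (n<1+n _) ∣cs∣<∣w∣)

occ-leadingZeros : ∀ x w s z → occ (suc x ∷ w) (replicate z 0 ++ s) ≡ occ (suc x ∷ w) s
occ-leadingZeros x w s zero    = refl
occ-leadingZeros x w s (suc z) = occ-leadingZeros x w s z

module Digits (m : ℕ) .{{_ : NonZero m}} where

  paddedDigits : ℕ → ℕ → List ℕ
  paddedDigits zero    r = []
  paddedDigits (suc n) r = r / m ^ n ∷ paddedDigits n (r % m ^ n)
    where instance _ = m^n≢0 m n

  length-paddedDigits : ∀ n r → length (paddedDigits n r) ≡ n
  length-paddedDigits zero    r = refl
  length-paddedDigits (suc n) r = cong suc (length-paddedDigits n _)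

  paddedDigits-∷ : ∀ n q {r} → r < m ^ n →
    paddedDigits (suc n) (q * m ^ n + r) ≡ q ∷ paddedDigits n r
  paddedDigits-∷ n q r<m^n =
    cong₂ _∷_ ([q*n+r]/n≡q q (m ^ n) r<m^n) (cong (paddedDigits n) ([q*n+r]%n≡r q (m ^ n) r<m^n))
    where instance _ = m^n≢0 m n

  paddedDigits-zero : ∀ n → paddedDigits n 0 ≡ replicate n 0
  paddedDigits-zero zero    = refl
  paddedDigits-zero (suc n) = cong₂ _∷_ (0/n≡0 (m ^ n))
    (trans (cong (paddedDigits n) (m<n⇒m%n≡m (m^n>0 m n))) (paddedDigits-zero n))
    where instance _ = m^n≢0 m n

  paddedDigits-∷ʳ : ∀ n r → r < m ^ suc n →
    paddedDigits (suc n) r ≡ paddedDigits n (r / m) ++ (r % m ∷ [])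
  paddedDigits-∷ʳ zero    r r<m =
    cong (_∷ []) (trans (n/1≡n r) (sym (m<n⇒m%n≡m (subst (r <_) (*-identityʳ m) r<m))))
  paddedDigits-∷ʳ (suc n) r _ = cong₂ _∷_ high (trans
    (paddedDigits-∷ʳ n (r % m ^ suc n) (m%n<n r _))
    (cong₂ (λ p q → paddedDigits n p ++ (q ∷ [])) middle low))
    where
    instance _ = m^n≢0 m n
    instance _ = m^n≢0 m (suc n)
    high : r / m ^ suc n ≡ r / m / m ^ n
    high = sym (m/n/o≡m/[n*o] r m (m ^ n))
    middle : r % m ^ suc n / m ≡ r / m % m ^ n
    middle = trans (/-congˡ (%-congʳ {{_}} {{m*n≢0 (m ^ n) m}} (*-comm m (m ^ n))))
                   (m%[n*o]/o≡m/o%n r (m ^ n) m {{_}} {{_}} {{m*n≢0 (m ^ n) m}})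
    low : r % m ^ suc n % m ≡ r % m
    low = m∣n⇒o%n%m≡o%m m (m ^ suc n) r (divides (m ^ n) (*-comm m (m ^ n)))

  val-foldl : ∀ acc v → foldl (λ acc d → acc * m + d) acc v ≡ acc * m ^ length v + val m v
  val-foldl acc []      = sym (trans (+-identityʳ _) (*-identityʳ acc))
  val-foldl acc (d ∷ v) = begin
    foldl (λ a d → a * m + d) (acc * m + d) v ≡⟨ val-foldl (acc * m + d) v ⟩
    (acc * m + d) * M + val m v               ≡⟨ regroup acc m d M (val m v) ⟩
    acc * (m * M) + (d * M + val m v)         ≡⟨ cong (acc * (m * M) +_) (sym (val-foldl d v)) ⟩
    acc * (m * M) + val m (d ∷ v)             ∎
    where
    open ≡-Reasoning
    M = m ^ length v
    regroup : ∀ a b c M V → (a * b + c) * M + V ≡ a * (b * M) + (c * M + V)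
    regroup = solve-∀

  val-∷ : ∀ d v → val m (d ∷ v) ≡ val m v + d * m ^ length v
  val-∷ d v = trans (val-foldl d v) (+-comm (d * m ^ length v) (val m v))

  val<m^length : ∀ v → All (_< m) v → val m v < m ^ length v
  val<m^length []      []           = z<s
  val<m^length (d ∷ v) (d<m ∷ v<m) = begin-strict
    val m (d ∷ v)   ≡⟨ val-∷ d v ⟩
    val m v + d * M <⟨ +-monoˡ-< (d * M) (val<m^length v v<m) ⟩
    M + d * M       ≤⟨ *-monoˡ-≤ M d<m ⟩
    m * M           ∎
    where
    open ≤-Reasoning
    M = m ^ length v

  isPrefix-paddedDigits : ∀ v j r .{{_ : NonZero (m ^ j)}} →
    All (_< m) v → r < m ^ (length v + j) →
    isPrefix v (paddedDigits (length v + j) r) ≡ (r / m ^ j ≡ᵇ val m v)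
  isPrefix-paddedDigits []      j r _ r<m^j = cong (_≡ᵇ 0) (sym (m<n⇒m/n≡0 r<m^j))
  isPrefix-paddedDigits (d ∷ v) j r (d<m ∷ v<m) _ = begin
    (d ≡ᵇ c) ∧ isPrefix v (paddedDigits n r′)
      ≡⟨ cong ((d ≡ᵇ c) ∧_) (isPrefix-paddedDigits v j r′ v<m (m%n<n r _)) ⟩
    (d ≡ᵇ c) ∧ (r′ / m ^ j ≡ᵇ val m v)
      ≡⟨ sym (≡ᵇ-radix (m ^ length v) c d r′/m^j<m^∣v∣ (val<m^length v v<m)) ⟩
    (r′ / m ^ j + c * m ^ length v ≡ᵇ val m v + d * m ^ length v)
      ≡⟨ sym (cong₂ _≡ᵇ_ r/m^j (val-∷ d v)) ⟩
    (r / m ^ j ≡ᵇ val m (d ∷ v)) ∎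
    where
    open ≡-Reasoning
    n = length v + j
    instance _ = m^n≢0 m (length v)
    instance _ = m^n≢0 m n
    c = r / m ^ n
    r′ = r % m ^ n
    m^n≡m^∣v∣*m^j : m ^ n ≡ m ^ length v * m ^ j
    m^n≡m^∣v∣*m^j = ^-distribˡ-+-* m (length v) j
    r′/m^j<m^∣v∣ : r′ / m ^ j < m ^ length v
    r′/m^j<m^∣v∣ = m<n*o⇒m/o<n (subst (r′ <_) m^n≡m^∣v∣*m^j (m%n<n r (m ^ n)))
    r/m^j : r / m ^ j ≡ r′ / m ^ j + c * m ^ length v
    r/m^j = begin
      r / m ^ j                                 ≡⟨ /-congˡ (m≡m%n+[m/n]*n r (m ^ n)) ⟩
      (r′ + c * m ^ n) / m ^ j                  ≡⟨ /-congˡ (cong (λ s → r′ + c * s) m^n≡m^∣v∣*m^j) ⟩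
      (r′ + c * (m ^ length v * m ^ j)) / m ^ j ≡⟨ /-congˡ (cong (r′ +_) (sym (*-assoc c _ _))) ⟩
      (r′ + c * m ^ length v * m ^ j) / m ^ j   ≡⟨ +-distrib-/-∣ʳ r′ (divides-refl (c * m ^ length v)) ⟩
      r′ / m ^ j + c * m ^ length v * m ^ j / m ^ j
                                                ≡⟨ cong (r′ / m ^ j +_) (m*n/n≡m (c * m ^ length v) (m ^ j)) ⟩
      r′ / m ^ j + c * m ^ length v             ∎

module Expansion (m : ℕ) .{{_ : NonZero m}} (2≤m : 2 ≤ m) where
  open Digits m

  -- [i]_m, except that 0 has the empty expansion.
  expansion : ℕ → List ℕ
  expansion i = digitsAux m i i []

  private
    suc/m≤n : ∀ n → suc n / m ≤ n
    suc/m≤n n = ≤-pred (m/n<m (suc n) m 2≤m)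

  digitsAux-fuel : ∀ f g n acc → n ≤ f → n ≤ g → digitsAux m f n acc ≡ digitsAux m g n acc
  digitsAux-fuel zero    zero    n       acc _         _         = refl
  digitsAux-fuel zero    (suc g) zero    acc _         _         = refl
  digitsAux-fuel (suc f) zero    zero    acc _         _         = refl
  digitsAux-fuel (suc f) (suc g) zero    acc _         _         = refl
  digitsAux-fuel (suc f) (suc g) (suc n) acc (s≤s n≤f) (s≤s n≤g) =
    digitsAux-fuel f g (suc n / m) _ (≤-trans (suc/m≤n n) n≤f) (≤-trans (suc/m≤n n) n≤g)

  digitsAux-++ : ∀ f n acc → digitsAux m f n acc ≡ digitsAux m f n [] ++ acc
  digitsAux-++ zero    n       acc = refl
  digitsAux-++ (suc f) zero    acc = refl
  digitsAux-++ (suc f) (suc n) acc = begin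
    digitsAux m f q (d ∷ acc)                     ≡⟨ digitsAux-++ f q (d ∷ acc) ⟩
    digitsAux m f q [] ++ d ∷ acc                 ≡⟨ sym (++-assoc (digitsAux m f q []) (d ∷ []) acc) ⟩
    (digitsAux m f q [] ++ d ∷ []) ++ acc         ≡⟨ cong (_++ acc) (sym (digitsAux-++ f q (d ∷ []))) ⟩
    digitsAux m f q (d ∷ []) ++ acc               ∎
    where
    open ≡-Reasoning
    q = suc n / m
    d = suc n % m

  expansion-suc : ∀ n → expansion (suc n) ≡ expansion (suc n / m) ++ (suc n % m ∷ [])
  expansion-suc n = trans (digitsAux-++ n (suc n / m) (suc n % m ∷ []))
    (cong (_++ (suc n % m ∷ [])) (digitsAux-fuel n (suc n / m) (suc n / m) [] (suc/m≤n n) ≤-refl))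

  paddedDigits≡zeros++expansion : ∀ n i → i < m ^ n →
    Σ[ z ∈ ℕ ] paddedDigits n i ≡ replicate z 0 ++ expansion i
  paddedDigits≡zeros++expansion n       zero    _ = n , trans (paddedDigits-zero n) (sym (++-identityʳ _))
  paddedDigits≡zeros++expansion zero    (suc i) (s<s ())
  paddedDigits≡zeros++expansion (suc n) (suc i) i<m^n
    with paddedDigits≡zeros++expansion n (suc i / m)
           (m<n*o⇒m/o<n (subst (suc i <_) (*-comm m (m ^ n)) i<m^n))
  ... | z , eq = z , (begin
    paddedDigits (suc n) (suc i)                       ≡⟨ paddedDigits-∷ʳ n (suc i) i<m^n ⟩
    paddedDigits n q ++ (d ∷ [])                       ≡⟨ cong (_++ (d ∷ [])) eq ⟩
    (replicate z 0 ++ expansion q) ++ (d ∷ [])         ≡⟨ ++-assoc (replicate z 0) (expansion q) _ ⟩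
    replicate z 0 ++ expansion q ++ (d ∷ [])           ≡⟨ cong (replicate z 0 ++_) (sym (expansion-suc i)) ⟩
    replicate z 0 ++ expansion (suc i)                 ∎)
    where
    open ≡-Reasoning
    q = suc i / m
    d = suc i % m

module Occurrences (m : ℕ) .{{_ : NonZero m}} (2≤m : 2 ≤ m)
                   (x : ℕ) (w′ : List ℕ) (x<m : suc x < m) (w′<m : All (_< m) w′) where
  open Digits m
  open Expansion m 2≤m

  w : List ℕ
  w = suc x ∷ w′

  e≡occ-expansion : ∀ i → e m w i ≡ occ w (expansion i)
  -- [0]_m = 0 contains no occurrence of w since x ≠ 0.
  e≡occ-expansion zero    = refl
  e≡occ-expansion (suc i) = refl

  e≡occ-paddedDigits : ∀ n i → i < m ^ n → e m w i ≡ occ w (paddedDigits n i)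
  e≡occ-paddedDigits n i i<m^n with paddedDigits≡zeros++expansion n i i<m^n
  ... | z , eq = trans (e≡occ-expansion i)
    (sym (trans (cong (occ w) eq) (occ-leadingZeros x w′ (expansion i) z)))

  e-leadingDigit : ∀ n q {r} → q < m → r < m ^ n →
    e m w (q * m ^ n + r) ≡ (if isPrefix w (q ∷ paddedDigits n r) then 1 else 0) + e m w r
  e-leadingDigit n q {r} q<m r<M = begin
    e m w (q * M + r)                        ≡⟨ e≡occ-paddedDigits (suc n) _ (q*n+r<m*n q<m r<M) ⟩
    occ w (paddedDigits (suc n) (q * M + r)) ≡⟨ cong (occ w) (paddedDigits-∷ n q r<M) ⟩
    atFront + occ w (paddedDigits n r)       ≡⟨ cong (atFront +_) (sym (e≡occ-paddedDigits n r r<M)) ⟩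
    atFront + e m w r                        ∎
    where
    open ≡-Reasoning
    M = m ^ n
    atFront = if isPrefix w (q ∷ paddedDigits n r) then 1 else 0

  a-leadingDigit-≢ : ∀ n q {r} → q < m → q ≢ suc x → r < m ^ n →
    a m w (q * m ^ n + r) ≡ a m w r
  a-leadingDigit-≢ n q {r} q<m q≢x r<M = cong (_% m) (trans (e-leadingDigit n q q<m r<M)
    (cong (λ b → (if b ∧ isPrefix w′ (paddedDigits n r) then 1 else 0) + e m w r) x≢ᵇq))
    where
    x≢ᵇq : (suc x ≡ᵇ q) ≡ false
    x≢ᵇq = T-ext (λ t → q≢x (sym (≡ᵇ⇒≡ _ _ t))) λ ()

  a-below-m^∣w∣ : ∀ i → i < m ^ length w → a m w i ≡ (if i ≡ᵇ val m w then 1 else 0)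
  a-below-m^∣w∣ i i<m^∣w∣ = begin
    e m w i % m
      ≡⟨ cong (_% m) (e≡occ-paddedDigits (length w) i i<m^∣w∣) ⟩
    occ w (paddedDigits (length w) i) % m
      ≡⟨ cong₂ (λ b t → ((if b then 1 else 0) + t) % m) atHead later ⟩
    ((if i ≡ᵇ val m w then 1 else 0) + 0) % m
      ≡⟨ indicator%m (i ≡ᵇ val m w) ⟩
    (if i ≡ᵇ val m w then 1 else 0) ∎
    where
    open ≡-Reasoning
    atHead : isPrefix w (paddedDigits (length w) i) ≡ (i ≡ᵇ val m w)
    ∣w∣+0≡∣w∣ = +-identityʳ (length w)
    atHead = trans (cong (λ n → isPrefix w (paddedDigits n i)) (sym ∣w∣+0≡∣w∣))
      (trans (isPrefix-paddedDigits w 0 i (x<m ∷ w′<m) (subst (λ n → i < m ^ n) (sym ∣w∣+0≡∣w∣) i<m^∣w∣))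
             (cong (_≡ᵇ val m w) (n/1≡n i)))
    later : ∀ {r} → occ w (paddedDigits (length w′) r) ≡ 0
    later {r} = occ-short w (paddedDigits (length w′) r)
      (subst (_< length w) (sym (length-paddedDigits (length w′) r)) ≤-refl)
    indicator%m : ∀ b → ((if b then 1 else 0) + 0) % m ≡ (if b then 1 else 0)
    indicator%m true  = m<n⇒m%n≡m 2≤m
    indicator%m false = m<n⇒m%n≡m (≤-trans z<s 2≤m)

  u-step : List ℕ → List ℕ
  u-step v = concat (replicate (suc x) v) ++ φ m w v ++ concat (replicate (m ∸ suc x ∸ 1) v)

  module _ (k : ℕ) where

    L : ℕ
    L = m ^ (length w + k)

    ∣w∣+k≡∣w′∣+[1+k] : length w + k ≡ length w′ + suc k
    ∣w∣+k≡∣w′∣+[1+k] = sym (+-suc (length w′) k)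

    L≡m^∣w′∣*m^[1+k] : L ≡ m ^ length w′ * m ^ suc k
    L≡m^∣w′∣*m^[1+k] = trans (cong (m ^_) ∣w∣+k≡∣w′∣+[1+k]) (^-distribˡ-+-* m (length w′) (suc k))

    isPrefix-x∷≡inRange : ∀ r → r < L →
      isPrefix w (suc x ∷ paddedDigits (length w + k) r) ≡ inRange m w L r
    isPrefix-x∷≡inRange r r<L = begin
      (suc x ≡ᵇ suc x) ∧ isPrefix w′ (paddedDigits (length w + k) r)
        ≡⟨ cong₂ _∧_ (Equivalence.to T-≡ (≡⇒≡ᵇ x x refl))
                     (cong (λ n → isPrefix w′ (paddedDigits n r)) ∣w∣+k≡∣w′∣+[1+k]) ⟩
      isPrefix w′ (paddedDigits (length w′ + suc k) r)
        ≡⟨ isPrefix-paddedDigits w′ (suc k) r w′<m (subst (λ n → r < m ^ n) ∣w∣+k≡∣w′∣+[1+k] r<L) ⟩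
      (r / m ^ suc k ≡ᵇ val m w′)
        ≡⟨ sym (inWindow≡quotient (m ^ length w′) (m ^ suc k) (val m w′) r) ⟩
      window (m ^ length w′ * m ^ suc k)
        ≡⟨ cong window (sym L≡m^∣w′∣*m^[1+k]) ⟩
      inRange m w L r ∎
      where
      open ≡-Reasoning
      instance _ = m^n≢0 m (length w′)
      instance _ = m^n≢0 m (suc k)
      window : ℕ → Bool
      window N = (val m w′ * N ≤ᵇ r * m ^ length w′) ∧ (r * m ^ length w′ <ᵇ (val m w′ + 1) * N)

    a-leadingDigit-x : ∀ r → r < L →
      a m w (suc x * L + r) ≡ (if inRange m w L r then (a m w r + 1) % m else a m w r)
    a-leadingDigit-x r r<L
      with inRange m w L r | trans (e-leadingDigit (length w + k) (suc x) x<m r<L)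
                                   (cong (λ b → (if b then 1 else 0) + e m w r) (isPrefix-x∷≡inRange r r<L))
    ... | true  | e≡1+e = trans (cong (_% m) e≡1+e) ([1+t]%n≡[t%n+1]%n (e m w r) m)
    ... | false | e≡e   = cong (_% m) e≡e

    applyUpTo-a-step : applyUpTo (a m w) (m ^ (length w + suc k)) ≡ u-step (applyUpTo (a m w) L)
    applyUpTo-a-step = begin
      applyUpTo f (m ^ (length w + suc k))
        ≡⟨ cong (applyUpTo f) size ⟩
      applyUpTo f (X * L + (L + c * L))
        ≡⟨ applyUpTo-++ f (X * L) (L + c * L) ⟩
      applyUpTo f (X * L) ++ applyUpTo (λ r → f (X * L + r)) (L + c * L)
        ≡⟨ cong (applyUpTo f (X * L) ++_) (applyUpTo-++ (λ r → f (X * L + r)) L (c * L)) ⟩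
      applyUpTo f (X * L) ++ applyUpTo (λ r → f (X * L + r)) L ++ applyUpTo (λ r → f (X * L + (L + r))) (c * L)
        ≡⟨ cong₂ _++_ before (cong₂ _++_ window after) ⟩
      concat (replicate X A) ++ φ m w A ++ concat (replicate c A) ∎
      where
      open ≡-Reasoning
      f = a m w
      X = suc x
      c = m ∸ X ∸ 1
      A = applyUpTo f L
      size : m ^ (length w + suc k) ≡ X * L + (L + c * L)
      size = trans (cong (m ^_) (+-suc (length w) k))
        (trans (cong (_* L) (sym (x+suc[m∸x∸1]≡m x<m))) (*-distribʳ-+ L X (suc c)))
      before : applyUpTo f (X * L) ≡ concat (replicate X A)
      before = applyUpTo-concat-replicate f L A X λ j j<X → applyUpTo-cong L λ r r<L →
        a-leadingDigit-≢ (length w + k) j (<-trans j<X x<m) (λ j≡X → <-irrefl j≡X j<X) r<L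
      φ-upTo : ∀ v n → length v ≡ n →
        φ m w v ≡ zipWith (λ i d → if inRange m w n i then (d + 1) % m else d) (upTo n) v
      φ-upTo v _ refl = refl
      window : applyUpTo (λ r → f (X * L + r)) L ≡ φ m w A
      window = trans (applyUpTo-cong L a-leadingDigit-x)
        (sym (trans (φ-upTo A L (length-applyUpTo f L)) (zipWith-applyUpTo _ (λ i → i) f L)))
      regroup : ∀ X L j r → X * L + (L + (j * L + r)) ≡ (X + suc j) * L + r
      regroup = solve-∀
      after : applyUpTo (λ r → f (X * L + (L + r))) (c * L) ≡ concat (replicate c A)
      after = applyUpTo-concat-replicate (λ r → f (X * L + (L + r))) L A c λ j j<c →
        applyUpTo-cong L λ r r<L → trans (cong f (regroup X L j r))
          (a-leadingDigit-≢ (length w + k) (X + suc j)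
            (subst (X + suc j <_) (x+suc[m∸x∸1]≡m x<m) (+-monoʳ-< X (s<s j<c))) (m+1+n≢m X) r<L)

  u≡applyUpTo-a : ∀ k → u m (suc x) w k ≡ applyUpTo (a m w) (m ^ (length w + k))
  u≡applyUpTo-a zero = begin
    u₀ m w                                 ≡⟨ map-upTo indicator (m ^ length w) ⟩
    applyUpTo indicator (m ^ length w)     ≡⟨ applyUpTo-cong _ (λ i i<m^∣w∣ → sym (a-below-m^∣w∣ i i<m^∣w∣)) ⟩
    applyUpTo (a m w) (m ^ length w)       ≡⟨ cong (λ n → applyUpTo (a m w) (m ^ n)) (sym (+-identityʳ (length w))) ⟩
    applyUpTo (a m w) (m ^ (length w + 0)) ∎
    where
    open ≡-Reasoning
    indicator : ℕ → ℕ
    indicator i = if i ≡ᵇ val m w then 1 else 0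
  u≡applyUpTo-a (suc k) = trans (cong u-step (u≡applyUpTo-a k)) (sym (applyUpTo-a-step k))

proposition3 : (m : ℕ) .{{_ : NonZero m}} → 2 ≤ m → (x : ℕ) → 1 ≤ x → x < m →
    (w : List ℕ) → All (λ d → d < m) w → head w ≡ just x →
    ((k i : ℕ) (h : i < length (u m x w k)) → lookup (u m x w k) (fromℕ< h) ≡ a m w i)
    × ((N : ℕ) → ∃ λ k → N ≤ length (u m x w k))
proposition3 m 2≤m zero    () _
proposition3 m 2≤m (suc x) _  x<m []       _            ()
proposition3 m 2≤m (suc x) _  x<m (_ ∷ w′) (_ ∷ w′<m) refl =
  (λ k i i<∣u∣ → lookup-≡applyUpTo (u≡applyUpTo-a k) i<∣u∣) , (λ N → N , N≤length-u N)
  where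
  open Occurrences m 2≤m x w′ x<m w′<m
  length-u : ∀ k → length (u m (suc x) w k) ≡ m ^ (length w + k)
  length-u k = trans (cong length (u≡applyUpTo-a k)) (length-applyUpTo (a m w) _)
  N≤length-u : ∀ N → N ≤ length (u m (suc x) w N)
  N≤length-u N = subst (N ≤_) (sym (length-u N))
    (<⇒≤ (<-≤-trans (n<m^n 2≤m N) (^-monoʳ-≤ m (m≤n+m N (length w)))))
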